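{- Let $G$ be a finite group and let $\Sigma=\mathrm{Cay}(G,(T_{i,j})_{5\times 5})$ be a $5$-PGSR of $G$ such that, for some integer $k$ with $2\leq k\leq|G|$: (a) the vertices $(g,1)$, $(g,2)$ and $(g,3)$ have valency $k+1$ for each $g\in G$; (b) the vertices $(g,4)$ and $(g,5)$ have valency $k$ for each $g\in G$; (c) for each $g\in G$ and $i\in\{1,\dots,5\}$ there is a $3$-cycle of $\Sigma$ through $(g,i)$. Then $G$ has an $m$-HGR for each odd integer $m\geq 7$.
   Context: For a finite group $G$ and integer $m\geq1$, let $(T_{i,j})_{m\times m}$ be a matrix of subsets of $G$ with $1\notin T_{i,i}$ and $T_{j,i}=T_{i,j}^{ -1}$ for all $i,j$. The $m$-Cayley graph $\mathrm{Cay}(G,(T_{i,j})_{m\times m})$ has vertex set $G\times\{1,\dots,m\}$ (write $g_i=(g,i)$, $G_i=G\times\{i\}$) and edges $\{g_i,(tg)_j\}$ for all $i,j$, $g\in G$, $t\in T_{i,j}$. An $m$-PGSR of $G$ is such an $m$-Cayley graph with $T_{1,1}=\dots=T_{m,m}=\emptyset$ (not necessarily regular) whose full automorphism group is isomorphic to $G$. For $m\geq2$, an $m$-HGR of $G$ is a regular $m$-partite graph whose automorphism group is isomorphic to $G$ and acts semiregularly on vertices with orbits the parts of the $m$-partition (each part independent); equivalently, a regular $m$-Cayley graph of $G$ with all $T_{i,i}=\emptyset$ whose automorphism group is isomorphic to $G$. -}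

module Defs where

open import Data.Nat using (ℕ; zero; suc; _+_; _≤_)
open import Data.Fin using (Fin)
open import Data.Bool using (Bool; true; false; if_then_else_)
open import Data.Product using (Σ; _×_; _,_; ∃-syntax)
open import Function using (_∘_; _⇔_)
open import Relation.Binary.PropositionalEquality using (_≡_; _≗_)
open import Algebra.Structures using (IsGroup)

-- A finite group: a group structure (w.r.t. propositional equality) on Fin order.
-- Every finite group is isomorphic to one of this form.
record FinGroup : Set where
  field
    order   : ℕ
    _∙_     : Fin order → Fin order → Fin order
    ε       : Fin order
    _⁻¹     : Fin order → Fin order
    isGroup : IsGroup _≡_ _∙_ ε _⁻¹

sumFin : (k : ℕ) → (Fin k → ℕ) → ℕ
sumFin zero    f = 0
sumFin (suc k) f = f Fin.zero + sumFin k (λ i → f (Fin.suc i))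

module _ (G : FinGroup) where
  open FinGroup G

  SubsetMatrix : ℕ → Set
  SubsetMatrix m = Fin m → Fin m → Fin order → Bool

  IsCayleyData : (m : ℕ) → SubsetMatrix m → Set
  IsCayleyData m T =
    ((i : Fin m) → T i i ε ≡ false) ×
    ((i j : Fin m) (t : Fin order) → T j i t ≡ T i j (t ⁻¹))

  DiagEmpty : (m : ℕ) → SubsetMatrix m → Set
  DiagEmpty m T = (i : Fin m) (t : Fin order) → T i i t ≡ false

  -- vertex set G × {1..m}; vertex (g , i) stands for g_i
  Vertex : ℕ → Set
  Vertex m = Fin order × Fin m

  -- adjacency in Cay(G,(T_ij)): g_i ~ h_j iff h = t g for some t ∈ T i j,
  -- i.e. iff h g⁻¹ ∈ T i j
  adjB : (m : ℕ) → SubsetMatrix m → Vertex m → Vertex m → Bool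
  adjB m T (g , i) (h , j) = T i j (h ∙ (g ⁻¹))

  Adj : (m : ℕ) → SubsetMatrix m → Vertex m → Vertex m → Set
  Adj m T u v = adjB m T u v ≡ true

  valency : (m : ℕ) → SubsetMatrix m → Vertex m → ℕ
  valency m T u =
    sumFin order (λ h → sumFin m (λ j → if adjB m T u (h , j) then 1 else 0))

  IsRegular : (m : ℕ) → SubsetMatrix m → Set
  IsRegular m T = ∃[ d ] ((v : Vertex m) → valency m T v ≡ d)

  record IsAutomorphism (m : ℕ) (T : SubsetMatrix m) (σ : Vertex m → Vertex m) : Set where
    field
      inverse   : Vertex m → Vertex m
      inverseˡ  : (v : Vertex m) → inverse (σ v) ≡ v
      inverseʳ  : (v : Vertex m) → σ (inverse v) ≡ v
      preserves : (u v : Vertex m) → Adj m T u v ⇔ Adj m T (σ u) (σ v)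

  AutIsoG : (m : ℕ) → SubsetMatrix m → Set
  AutIsoG m T =
    Σ (Fin order → Vertex m → Vertex m) λ φ →
      ((g : Fin order) → IsAutomorphism m T (φ g)) ×
      ((g h : Fin order) → φ (g ∙ h) ≗ (φ g ∘ φ h)) ×
      ((g h : Fin order) → φ g ≗ φ h → g ≡ h) ×
      ((σ : Vertex m → Vertex m) → IsAutomorphism m T σ → ∃[ g ] (φ g ≗ σ))

  IsPGSR : (m : ℕ) → SubsetMatrix m → Set
  IsPGSR m T = IsCayleyData m T × DiagEmpty m T × AutIsoG m T

  HasHGR : (m : ℕ) → Set
  HasHGR m = 2 ≤ m × (∃[ T ] (IsCayleyData m T × DiagEmpty m T × IsRegular m T × AutIsoG m T))

  HasTriangleThrough : (m : ℕ) → SubsetMatrix m → Vertex m → Set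
  HasTriangleThrough m T v =
    ∃[ u ] ∃[ w ] (Adj m T v u × Adj m T u w × Adj m T w v)

{-# OPTIONS --safe #-}
-- Glue to Σ a ladder on 2n + 2 new parts. Its two rails are chains of n + 1 parts, consecutive
-- parts being joined by identity matchings, and they start, again by identity matchings, at the
-- two parts of Σ of valency k; its j-th rung joins the j-th parts of the two rails by k − 1
-- translates (k on the last rung). Then every vertex has valency k + 1. The ladder is bipartite,
-- a new vertex has at most one neighbour in Σ and a vertex of Σ at most one new neighbour, so no
-- new vertex lies on a triangle, while every vertex of Σ does. Hence an automorphism σ maps Σ onto
-- itself; as Aut Σ ≅ G, its restriction is a right translation ρ h. Finally σ = ρ h everywhere,
-- because agreement spreads along the rails: the next part on a rail carries the only neighbour of
-- a vertex that is not yet known to agree.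
module Submission where

open import Defs
open import Algebra.Structures using (IsGroup)
open import Algebra.Bundles using (Group)
import Algebra.Properties.Group as GroupProperties
open import Level using (0ℓ)
open import Data.Bool using (Bool; true; false; if_then_else_; not; _∧_; _∨_)
open import Data.Bool.Properties using (T-≡; ∧-comm; ∨-comm; not-¬; not-involutive)
open import Data.Empty using (⊥; ⊥-elim)
open import Data.Fin using (Fin; zero; suc; toℕ; inject₁; punchOut; splitAt; _↑ˡ_; _↑ʳ_)
open import Data.Fin.Permutation using (Permutation′; permutation; _⟨$⟩ʳ_)
import Data.Fin.Properties as Fin
open import Data.Fin.Properties using (splitAt-↑ˡ; splitAt-↑ʳ; splitAt⁻¹-↑ˡ; splitAt⁻¹-↑ʳ; ↑ˡ-injective)
open import Data.Nat using (ℕ; zero; suc; _+_; _*_; _∸_; _<_; _≤_; _<ᵇ_; ⌊_/2⌋; z≤n; s≤s)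
open import Data.Nat.Induction using (<-rec)
import Data.Nat.Properties as ℕ
open import Data.Product using (_×_; _,_; proj₁; proj₂; ∃-syntax)
open import Data.Sum using (_⊎_; inj₁; inj₂)
open import Function using (_∘_; mk⇔; Equivalence)
open import Relation.Nullary using (¬_; yes; no; contradiction)
open import Relation.Nullary.Decidable using (Dec; does; dec-true; dec-false; does-⇔)
open import Relation.Binary.PropositionalEquality
open import Algebra.Properties.Semiring.Sum ℕ.+-*-semiring
  using (sum; sum-cong-≗; ∑-distrib-+; ∑-comm; sum-permute; sum-replicate-zero; *-distribʳ-sum)

-- Counting Bool-valued subsets of Fin N

𝟙 : Bool → ℕ
𝟙 b = if b then 1 else 0

count : ∀ {N} → (Fin N → Bool) → ℕ
count S = sum (𝟙 ∘ S)

｛_｝ : ∀ {N} → Fin N → Fin N → Bool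
｛ c ｝ t = does (t Fin.≟ c)

module _ {N : ℕ} where

  count-cong : {S S′ : Fin N → Bool} → S ≗ S′ → count S ≡ count S′
  count-cong S≗S′ = sum-cong-≗ (cong 𝟙 ∘ S≗S′)

  count-∅ : count {N} (λ _ → false) ≡ 0
  count-∅ = sum-replicate-zero N

  count-∧ : ∀ b (S : Fin N → Bool) → count (λ t → b ∧ S t) ≡ 𝟙 b * count S
  count-∧ true  S = sym (ℕ.+-identityʳ (count S))
  count-∧ false S = count-∅

  count-∨ : (S S′ : Fin N → Bool) → (∀ t → S t ≡ true → S′ t ≡ false) →
            count (λ t → S t ∨ S′ t) ≡ count S + count S′
  count-∨ S S′ disjoint = trans (sum-cong-≗ 𝟙-∨) (∑-distrib-+ (𝟙 ∘ S) (𝟙 ∘ S′))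
    where
    𝟙-∨ : ∀ t → 𝟙 (S t ∨ S′ t) ≡ 𝟙 (S t) + 𝟙 (S′ t)
    𝟙-∨ t with S t in St
    ... | true  rewrite disjoint t St = refl
    ... | false = refl

  count-permute : (S : Fin N → Bool) (π : Permutation′ N) → count (S ∘ (π ⟨$⟩ʳ_)) ≡ count S
  count-permute S π = sym (sum-permute (𝟙 ∘ S) π)

count-｛｝ : ∀ {N} (c : Fin N) → count ｛ c ｝ ≡ 1
count-｛｝ {suc N} zero    = cong suc (count-∅ {N})
count-｛｝ {suc N} (suc c) = count-｛｝ c

count-toℕ≡ : ∀ N c → count {N} (λ t → does (toℕ t ℕ.≟ c)) ≡ 𝟙 (c <ᵇ N)
count-toℕ≡ zero    c       = refl
count-toℕ≡ (suc N) zero    = cong suc (count-∅ {N})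
count-toℕ≡ (suc N) (suc c) = count-toℕ≡ N c

count-toℕ< : ∀ {N c} → c ≤ N → count {N} (λ t → toℕ t <ᵇ c) ≡ c
count-toℕ< {N} z≤n       = count-∅ {N}
count-toℕ<     (s≤s c≤N) = cong suc (count-toℕ< c≤N)

∨-true : ∀ a b → a ∨ b ≡ true → a ≡ true ⊎ b ≡ true
∨-true true  b _  = inj₁ refl
∨-true false b eq = inj₂ eq

∧-true : ∀ a b → a ∧ b ≡ true → a ≡ true × b ≡ true
∧-true true true _ = refl , refl

does⇒ : ∀ {A : Set} (a? : Dec A) → does a? ≡ true → A
does⇒ (yes a) _  = a
does⇒ (no _)  ()

𝟙≤1 : ∀ b → 𝟙 b ≤ 1
𝟙≤1 true  = s≤s z≤n
𝟙≤1 false = z≤n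

<⇒<ᵇ≡true : ∀ {a b} → a < b → (a <ᵇ b) ≡ true
<⇒<ᵇ≡true a<b = Equivalence.to T-≡ (ℕ.<⇒<ᵇ a<b)

-- Cayley graphs, right translations and automorphisms

asGroup : FinGroup → Group 0ℓ 0ℓ
asGroup G = record { isGroup = FinGroup.isGroup G }

sumFin≡sum : ∀ n (f : Fin n → ℕ) → sumFin n f ≡ sum f
sumFin≡sum zero    f = refl
sumFin≡sum (suc n) f = cong (f zero +_) (sumFin≡sum n (f ∘ suc))

injective⇒surjective : ∀ {N} (f : Fin N → Fin N) → (∀ a b → f a ≡ f b → a ≡ b) →
                       ∀ y → ∃[ x ] f x ≡ y
injective⇒surjective {suc N} f f-injective y with Fin.any? (λ x → f x Fin.≟ y)
... | yes hit = hit
... | no miss = contradiction (Fin.injective⇒≤ punchOut-injective) (ℕ.n≮n N)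
  where
  y≢f : ∀ x → y ≢ f x
  y≢f x y≡fx = miss (x , sym y≡fx)
  punchOut-injective : ∀ {a b} → punchOut (y≢f a) ≡ punchOut (y≢f b) → a ≡ b
  punchOut-injective {a} {b} eq = f-injective a b (Fin.punchOut-injective (y≢f a) (y≢f b) eq)

module CayleyGraph (G : FinGroup) where
  open FinGroup G
  open IsGroup isGroup using (assoc; identityˡ)
  open GroupProperties (asGroup G)
    using (⁻¹-involutive; ⁻¹-anti-homo-∙; ⁻¹-anti-homo-//; ⁻¹-injective; //-rightDividesˡ; //-rightDividesʳ)
  open ≡-Reasoning

  count-⁻¹ : (S : Fin order → Bool) → count (S ∘ _⁻¹) ≡ count S
  count-⁻¹ S = count-permute S (permutation _⁻¹ _⁻¹ ⁻¹-involutive ⁻¹-involutive)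

  count-∙ʳ : (S : Fin order → Bool) (g : Fin order) → count (λ t → S (t ∙ g)) ≡ count S
  count-∙ʳ S g = count-permute S
    (permutation (_∙ g) (_∙ (g ⁻¹)) (//-rightDividesˡ g) (//-rightDividesʳ g))

  valency≡∑count : ∀ m (T : SubsetMatrix G m) g i → valency G m T (g , i) ≡ sum (λ j → count (T i j))
  valency≡∑count m T g i = begin
    sumFin order (λ h → sumFin m (λ j → 𝟙 (T i j (h ∙ (g ⁻¹)))))
      ≡⟨ sumFin≡sum order _ ⟩
    sum (λ h → sumFin m (λ j → 𝟙 (T i j (h ∙ (g ⁻¹)))))
      ≡⟨ sum-cong-≗ {order} (λ h → sumFin≡sum m _) ⟩
    sum (λ h → sum (λ j → 𝟙 (T i j (h ∙ (g ⁻¹)))))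
      ≡⟨ ∑-comm (λ h j → 𝟙 (T i j (h ∙ (g ⁻¹)))) ⟩
    sum (λ j → count (λ h → T i j (h ∙ (g ⁻¹))))
      ≡⟨ sum-cong-≗ (λ j → count-∙ʳ (T i j) (g ⁻¹)) ⟩
    sum (λ j → count (T i j)) ∎

  ρ : ∀ {m} → Fin order → Vertex G m → Vertex G m
  ρ g (x , i) = (x ∙ (g ⁻¹) , i)

  ρ⁻¹ : ∀ {m} → Fin order → Vertex G m → Vertex G m
  ρ⁻¹ g (x , i) = (x ∙ g , i)

  ρ-ρ⁻¹ : ∀ {m} g (v : Vertex G m) → ρ g (ρ⁻¹ g v) ≡ v
  ρ-ρ⁻¹ g (x , i) = cong (_, i) (//-rightDividesʳ g x)

  ρ⁻¹-ρ : ∀ {m} g (v : Vertex G m) → ρ⁻¹ g (ρ g v) ≡ v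
  ρ⁻¹-ρ g (x , i) = cong (_, i) (//-rightDividesˡ g x)

  ∙-//-cancel : ∀ x y c → (y ∙ c) ∙ ((x ∙ c) ⁻¹) ≡ y ∙ (x ⁻¹)
  ∙-//-cancel x y c = begin
    (y ∙ c) ∙ ((x ∙ c) ⁻¹)        ≡⟨ cong ((y ∙ c) ∙_) (⁻¹-anti-homo-∙ x c) ⟩
    (y ∙ c) ∙ ((c ⁻¹) ∙ (x ⁻¹))   ≡⟨ sym (assoc (y ∙ c) (c ⁻¹) (x ⁻¹)) ⟩
    ((y ∙ c) ∙ (c ⁻¹)) ∙ (x ⁻¹)   ≡⟨ cong (_∙ (x ⁻¹)) (//-rightDividesʳ c y) ⟩
    y ∙ (x ⁻¹)                    ∎

  adjB-ρ : ∀ {m} (T : SubsetMatrix G m) g (u v : Vertex G m) → adjB G m T (ρ g u) (ρ g v) ≡ adjB G m T u v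
  adjB-ρ T g (x , i) (y , j) = cong (T i j) (∙-//-cancel x y (g ⁻¹))

  ρ-isAutomorphism : ∀ {m} (T : SubsetMatrix G m) g → IsAutomorphism G m T (ρ g)
  ρ-isAutomorphism T g = record
    { inverse   = ρ⁻¹ g
    ; inverseˡ  = ρ⁻¹-ρ g
    ; inverseʳ  = ρ-ρ⁻¹ g
    ; preserves = λ u v → mk⇔ (trans (adjB-ρ T g u v)) (trans (sym (adjB-ρ T g u v)))
    }

  ρ-∙ : ∀ {m} g h → ρ {m} (g ∙ h) ≗ ρ g ∘ ρ h
  ρ-∙ g h (x , i) = cong (_, i) (begin
    x ∙ ((g ∙ h) ⁻¹)        ≡⟨ cong (x ∙_) (⁻¹-anti-homo-∙ g h) ⟩
    x ∙ ((h ⁻¹) ∙ (g ⁻¹))   ≡⟨ sym (assoc x (h ⁻¹) (g ⁻¹)) ⟩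
    (x ∙ (h ⁻¹)) ∙ (g ⁻¹)   ∎)

  ρ-injective : ∀ {m} → Fin m → ∀ g h → ρ {m} g ≗ ρ h → g ≡ h
  ρ-injective i g h ρg≗ρh = ⁻¹-injective (begin
    g ⁻¹         ≡⟨ sym (identityˡ (g ⁻¹)) ⟩
    ε ∙ (g ⁻¹)   ≡⟨ cong proj₁ (ρg≗ρh (ε , i)) ⟩
    ε ∙ (h ⁻¹)   ≡⟨ identityˡ (h ⁻¹) ⟩
    h ⁻¹         ∎)

  Adj-symmetric : ∀ {m} {T : SubsetMatrix G m} → IsCayleyData G m T → ∀ u v → Adj G m T u v → Adj G m T v u
  Adj-symmetric {T = T} (_ , T-symmetric) (x , i) (y , j) u~v =
    trans (T-symmetric i j (x ∙ (y ⁻¹))) (trans (cong (T i j) (⁻¹-anti-homo-// x y)) u~v)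

  Adj-irreflexive : ∀ {m} {T : SubsetMatrix G m} → DiagEmpty G m T → ∀ v → ¬ Adj G m T v v
  Adj-irreflexive T-empty (x , i) v~v with trans (sym (T-empty i (x ∙ (x ⁻¹)))) v~v
  ... | ()

module Automorphisms (G : FinGroup) {m : ℕ} (T : SubsetMatrix G m) where
  open FinGroup G using (order)
  open CayleyGraph G
  open Equivalence using (to; from)

  IsRightTranslation : (Vertex G m → Vertex G m) → Set
  IsRightTranslation σ = ∃[ h ] ρ h ≗ σ

  inverse-isAutomorphism : ∀ {σ} (σ-aut : IsAutomorphism G m T σ) →
                           IsAutomorphism G m T (IsAutomorphism.inverse σ-aut)
  inverse-isAutomorphism {σ} σ-aut = record
    { inverse   = σ
    ; inverseˡ  = inverseʳ
    ; inverseʳ  = inverseˡ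
    ; preserves = λ u v → mk⇔
        (λ u~v → from (preserves (inverse u) (inverse v))
                      (subst₂ (Adj G m T) (sym (inverseʳ u)) (sym (inverseʳ v)) u~v))
        (λ u~v → subst₂ (Adj G m T) (inverseʳ u) (inverseʳ v) (to (preserves (inverse u) (inverse v)) u~v))
    }
    where open IsAutomorphism σ-aut

  triangle-preserved : ∀ {σ} → IsAutomorphism G m T σ → ∀ v →
                       HasTriangleThrough G m T v → HasTriangleThrough G m T (σ v)
  triangle-preserved {σ} σ-aut v (u , w , v~u , u~w , w~v) =
    σ u , σ w , preserve v u v~u , preserve u w u~w , preserve w v w~v
    where
    preserve : ∀ a b → Adj G m T a b → Adj G m T (σ a) (σ b)
    preserve a b = to (IsAutomorphism.preserves σ-aut a b)

  -- Each right translation ρ h is some φ (ψ h); ψ is injective as G acts faithfully, hence onto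
  -- as G is finite, so every φ g, in particular σ, is a right translation.
  AutIsoG⇒rightTranslations : Fin m → AutIsoG G m T →
    ∀ σ → IsAutomorphism G m T σ → IsRightTranslation σ
  AutIsoG⇒rightTranslations i (φ , _ , _ , _ , onto) σ σ-aut = h , λ v → trans (sym (φψh≗ρh v)) (φg≗σ v)
    where
    g : Fin order
    g = proj₁ (onto σ σ-aut)
    φg≗σ : φ g ≗ σ
    φg≗σ = proj₂ (onto σ σ-aut)
    ψ : Fin order → Fin order
    ψ h = proj₁ (onto (ρ h) (ρ-isAutomorphism T h))
    φψ≗ρ : ∀ h → φ (ψ h) ≗ ρ h
    φψ≗ρ h = proj₂ (onto (ρ h) (ρ-isAutomorphism T h))
    ψ-injective : ∀ a b → ψ a ≡ ψ b → a ≡ b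
    ψ-injective a b ψa≡ψb = ρ-injective i a b λ v →
      trans (sym (φψ≗ρ a v)) (trans (cong (λ c → φ c v) ψa≡ψb) (φψ≗ρ b v))
    h = proj₁ (injective⇒surjective ψ ψ-injective g)
    φψh≗ρh : φ g ≗ ρ h
    φψh≗ρh v = trans (cong (λ c → φ c v) (sym (proj₂ (injective⇒surjective ψ ψ-injective g)))) (φψ≗ρ h v)

  rightTranslations⇒AutIsoG : Fin m → (∀ σ → IsAutomorphism G m T σ → IsRightTranslation σ) → AutIsoG G m T
  rightTranslations⇒AutIsoG i onto = ρ , ρ-isAutomorphism T , ρ-∙ , ρ-injective i , onto

  agreement-propagates : ∀ {σ π} → IsAutomorphism G m T σ → IsAutomorphism G m T π →
    ∀ {u v} → σ u ≡ π u → Adj G m T u v → (∀ w → Adj G m T u w → σ w ≡ π w ⊎ w ≡ v) → σ v ≡ π v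
  agreement-propagates {σ} {π} σ-aut π-aut {u} {v} σu≡πu u~v agree-or-v =
    trans (sym (π-inverseʳ (σ v))) (cong π w≡v)
    where
    open IsAutomorphism π-aut renaming (inverse to π⁻¹; inverseʳ to π-inverseʳ; preserves to π-preserves)
    w : Vertex G m
    w = π⁻¹ (σ v)
    πu~πw : Adj G m T (π u) (π w)
    πu~πw = subst₂ (Adj G m T) σu≡πu (sym (π-inverseʳ (σ v))) (to (IsAutomorphism.preserves σ-aut u v) u~v)
    σ-injective : ∀ {a b} → σ a ≡ σ b → a ≡ b
    σ-injective {a} {b} σa≡σb = trans (sym (IsAutomorphism.inverseˡ σ-aut a))
      (trans (cong (IsAutomorphism.inverse σ-aut) σa≡σb) (IsAutomorphism.inverseˡ σ-aut b))
    w≡v : w ≡ v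
    w≡v with agree-or-v w (from (π-preserves u w) πu~πw)
    ... | inj₁ σw≡πw = σ-injective (trans σw≡πw (π-inverseʳ (σ v)))
    ... | inj₂ w≡v   = w≡v

-- Gluing two multi-Cayley graphs

sum-↑ : ∀ m₁ {m₂} (f : Fin (m₁ + m₂) → ℕ) → sum f ≡ sum (f ∘ (_↑ˡ m₂)) + sum (f ∘ (m₁ ↑ʳ_))
sum-↑ zero    f = refl
sum-↑ (suc m₁) f = trans (cong (f Fin.zero +_) (sum-↑ m₁ (f ∘ Fin.suc))) (sym (ℕ.+-assoc (f Fin.zero) _ _))

module Gluing (G : FinGroup) {m₁ m₂ : ℕ} (T : SubsetMatrix G m₁)
              (C : Fin m₁ → Fin m₂ → Fin (FinGroup.order G) → Bool) (L : SubsetMatrix G m₂) where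
  open FinGroup G
  open GroupProperties (asGroup G) using (⁻¹-involutive)
  open CayleyGraph G using (valency≡∑count; count-⁻¹)

  blocks : Fin m₁ ⊎ Fin m₂ → Fin m₁ ⊎ Fin m₂ → Fin order → Bool
  blocks (inj₁ a) (inj₁ b) = T a b
  blocks (inj₁ a) (inj₂ q) = C a q
  blocks (inj₂ q) (inj₁ a) = C a q ∘ _⁻¹
  blocks (inj₂ p) (inj₂ q) = L p q

  glue : SubsetMatrix G (m₁ + m₂)
  glue i j = blocks (splitAt m₁ i) (splitAt m₁ j)

  glue-↑ˡ-↑ˡ : ∀ a b → glue (a ↑ˡ m₂) (b ↑ˡ m₂) ≡ T a b
  glue-↑ˡ-↑ˡ a b rewrite splitAt-↑ˡ m₁ a m₂ | splitAt-↑ˡ m₁ b m₂ = refl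

  glue-↑ˡ-↑ʳ : ∀ a q → glue (a ↑ˡ m₂) (m₁ ↑ʳ q) ≡ C a q
  glue-↑ˡ-↑ʳ a q rewrite splitAt-↑ˡ m₁ a m₂ | splitAt-↑ʳ m₁ m₂ q = refl

  glue-↑ʳ-↑ˡ : ∀ q a → glue (m₁ ↑ʳ q) (a ↑ˡ m₂) ≡ C a q ∘ _⁻¹
  glue-↑ʳ-↑ˡ q a rewrite splitAt-↑ˡ m₁ a m₂ | splitAt-↑ʳ m₁ m₂ q = refl

  glue-↑ʳ-↑ʳ : ∀ p q → glue (m₁ ↑ʳ p) (m₁ ↑ʳ q) ≡ L p q
  glue-↑ʳ-↑ʳ p q rewrite splitAt-↑ʳ m₁ m₂ p | splitAt-↑ʳ m₁ m₂ q = refl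

  glue-isCayleyData : IsCayleyData G m₁ T → IsCayleyData G m₂ L → IsCayleyData G (m₁ + m₂) glue
  glue-isCayleyData (T-loopless , T-symmetric) (L-loopless , L-symmetric) =
    (λ i → blocks-loopless (splitAt m₁ i)) , (λ i j → blocks-symmetric (splitAt m₁ i) (splitAt m₁ j))
    where
    blocks-loopless : ∀ a → blocks a a ε ≡ false
    blocks-loopless (inj₁ a) = T-loopless a
    blocks-loopless (inj₂ q) = L-loopless q
    blocks-symmetric : ∀ a b t → blocks b a t ≡ blocks a b (t ⁻¹)
    blocks-symmetric (inj₁ a) (inj₁ b) = T-symmetric a b
    blocks-symmetric (inj₁ a) (inj₂ q) t = refl
    blocks-symmetric (inj₂ q) (inj₁ a) t = cong (C a q) (sym (⁻¹-involutive t))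
    blocks-symmetric (inj₂ p) (inj₂ q) = L-symmetric p q

  glue-diagEmpty : DiagEmpty G m₁ T → DiagEmpty G m₂ L → DiagEmpty G (m₁ + m₂) glue
  glue-diagEmpty T-empty L-empty i = blocks-empty (splitAt m₁ i)
    where
    blocks-empty : ∀ a t → blocks a a t ≡ false
    blocks-empty (inj₁ a) = T-empty a
    blocks-empty (inj₂ q) = L-empty q

  inl : Vertex G m₁ → Vertex G (m₁ + m₂)
  inl (x , a) = (x , a ↑ˡ m₂)

  inr : Vertex G m₂ → Vertex G (m₁ + m₂)
  inr (x , q) = (x , m₁ ↑ʳ q)

  data Side : Vertex G (m₁ + m₂) → Set where
    old : ∀ u → Side (inl u)
    new : ∀ w → Side (inr w)

  side : ∀ v → Side v
  side (x , i) with splitAt m₁ i in eq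
  ... | inj₁ a = subst Side (cong (x ,_) (splitAt⁻¹-↑ˡ eq)) (old (x , a))
  ... | inj₂ q = subst Side (cong (x ,_) (splitAt⁻¹-↑ʳ eq)) (new (x , q))

  valency-inl : ∀ g a → valency G (m₁ + m₂) glue (inl (g , a)) ≡
                        valency G m₁ T (g , a) + sum (λ q → count (C a q))
  valency-inl g a = begin
    valency G (m₁ + m₂) glue (g , a ↑ˡ m₂)
      ≡⟨ valency≡∑count (m₁ + m₂) glue g (a ↑ˡ m₂) ⟩
    sum (λ j → count (glue (a ↑ˡ m₂) j))
      ≡⟨ sum-↑ m₁ _ ⟩
    sum (λ b → count (glue (a ↑ˡ m₂) (b ↑ˡ m₂))) + sum (λ q → count (glue (a ↑ˡ m₂) (m₁ ↑ʳ q)))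
      ≡⟨ cong₂ _+_ (sum-cong-≗ (cong count ∘ glue-↑ˡ-↑ˡ a))
                   (sum-cong-≗ (cong count ∘ glue-↑ˡ-↑ʳ a)) ⟩
    sum (λ b → count (T a b)) + sum (λ q → count (C a q))
      ≡⟨ cong (_+ _) (sym (valency≡∑count m₁ T g a)) ⟩
    valency G m₁ T (g , a) + sum (λ q → count (C a q)) ∎
    where open ≡-Reasoning

  valency-inr : ∀ g q → valency G (m₁ + m₂) glue (inr (g , q)) ≡
                        sum (λ a → count (C a q)) + valency G m₂ L (g , q)
  valency-inr g q = begin
    valency G (m₁ + m₂) glue (g , m₁ ↑ʳ q)
      ≡⟨ valency≡∑count (m₁ + m₂) glue g (m₁ ↑ʳ q) ⟩
    sum (λ j → count (glue (m₁ ↑ʳ q) j))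
      ≡⟨ sum-↑ m₁ _ ⟩
    sum (λ a → count (glue (m₁ ↑ʳ q) (a ↑ˡ m₂))) + sum (λ p → count (glue (m₁ ↑ʳ q) (m₁ ↑ʳ p)))
      ≡⟨ cong₂ _+_ (sum-cong-≗ (λ a → trans (cong count (glue-↑ʳ-↑ˡ q a)) (count-⁻¹ (C a q))))
                   (sum-cong-≗ (cong count ∘ glue-↑ʳ-↑ʳ q)) ⟩
    sum (λ a → count (C a q)) + sum (λ p → count (L q p))
      ≡⟨ cong (_ +_) (sym (valency≡∑count m₂ L g q)) ⟩
    sum (λ a → count (C a q)) + valency G m₂ L (g , q) ∎
    where open ≡-Reasoning

  adjB-inl-inl : ∀ u u′ → adjB G (m₁ + m₂) glue (inl u) (inl u′) ≡ adjB G m₁ T u u′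
  adjB-inl-inl (x , a) (y , b) = cong-app (glue-↑ˡ-↑ˡ a b) (y ∙ (x ⁻¹))

  adjB-inr-inr : ∀ w w′ → adjB G (m₁ + m₂) glue (inr w) (inr w′) ≡ adjB G m₂ L w w′
  adjB-inr-inr (x , p) (y , q) = cong-app (glue-↑ʳ-↑ʳ p q) (y ∙ (x ⁻¹))

  adjB-inl-inr : ∀ x a y q → adjB G (m₁ + m₂) glue (inl (x , a)) (inr (y , q)) ≡ C a q (y ∙ (x ⁻¹))
  adjB-inl-inr x a y q = cong-app (glue-↑ˡ-↑ʳ a q) (y ∙ (x ⁻¹))

  inl-injective : ∀ {u u′} → inl u ≡ inl u′ → u ≡ u′
  inl-injective {x , a} {y , b} eq = cong₂ _,_ (cong proj₁ eq) (↑ˡ-injective m₂ a b (cong proj₂ eq))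

-- The ladder

partner : ℕ → ℕ
partner zero          = 1
partner (suc zero)    = 0
partner (suc (suc P)) = 2 + partner P

partner-involutive : ∀ P → partner (partner P) ≡ P
partner-involutive zero          = refl
partner-involutive (suc zero)    = refl
partner-involutive (suc (suc P)) = cong (2 +_) (partner-involutive P)

partner-⌊/2⌋ : ∀ P → ⌊ partner P /2⌋ ≡ ⌊ P /2⌋
partner-⌊/2⌋ zero          = refl
partner-⌊/2⌋ (suc zero)    = refl
partner-⌊/2⌋ (suc (suc P)) = cong suc (partner-⌊/2⌋ P)

partner<2+ : ∀ P → partner P < 2 + P
partner<2+ zero          = s≤s (s≤s z≤n)
partner<2+ (suc zero)    = s≤s z≤n
partner<2+ (suc (suc P)) = s≤s (s≤s (partner<2+ P))

partner≢ : ∀ P → partner P ≢ P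
partner≢ zero          ()
partner≢ (suc zero)    ()
partner≢ (suc (suc P)) = partner≢ P ∘ ℕ.suc-injective ∘ ℕ.suc-injective

partner≢2+ : ∀ P → partner P ≢ 2 + P
partner≢2+ zero          ()
partner≢2+ (suc zero)    ()
partner≢2+ (suc (suc P)) = partner≢2+ P ∘ ℕ.suc-injective ∘ ℕ.suc-injective

2+partner≢ : ∀ P → 2 + partner P ≢ P
2+partner≢ zero          ()
2+partner≢ (suc zero)    ()
2+partner≢ (suc (suc P)) = 2+partner≢ P ∘ ℕ.suc-injective ∘ ℕ.suc-injective

colour : ℕ → Bool
colour zero          = false
colour (suc zero)    = true
colour (suc (suc P)) = not (colour P)

colour-partner : ∀ P → colour (partner P) ≡ not (colour P)
colour-partner zero          = refl
colour-partner (suc zero)    = refl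
colour-partner (suc (suc P)) = cong not (colour-partner P)

<ᵇ-double : ∀ P c → (P <ᵇ 2 * c) ≡ (⌊ P /2⌋ <ᵇ c)
<ᵇ-double P             zero    = refl
<ᵇ-double zero          (suc c) = refl
<ᵇ-double (suc zero)    (suc c) rewrite ℕ.+-suc c (c + 0) = refl
<ᵇ-double (suc (suc P)) (suc c) rewrite ℕ.+-suc c (c + 0) = <ᵇ-double P c

does-≟-comm : ∀ (m n : ℕ) → does (m ℕ.≟ n) ≡ does (n ℕ.≟ m)
does-≟-comm m n = does-⇔ (mk⇔ sym sym) (m ℕ.≟ n) (n ℕ.≟ m)

module Ladder (G : FinGroup) (n k : ℕ) where
  open FinGroup G
  open GroupProperties (asGroup G) using (⁻¹-involutive; ε⁻¹≈ε)
  open CayleyGraph G using (count-⁻¹)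

  -- Part p sits at position toℕ p: even positions form one rail and odd positions the other,
  -- positions P and 2 + P are consecutive on a rail, and P and partner P share the rung ⌊ P /2⌋.
  M : ℕ
  M = 2 + 2 * n

  rungSize : ℕ → ℕ
  rungSize P = k ∸ 𝟙 (⌊ P /2⌋ <ᵇ n)

  -- A rung set is read from the end of colour false, so read from the other end it is inverted,
  -- as the symmetry condition of IsCayleyData requires.
  orient : ℕ → Fin order → Fin order
  orient P t = if colour P then t ⁻¹ else t

  rungSet : ℕ → Fin order → Bool
  rungSet P t = toℕ (orient P t) <ᵇ rungSize P

  rail : ℕ → ℕ → Bool
  rail P Q = does (Q ℕ.≟ 2 + P) ∨ does (P ℕ.≟ 2 + Q)

  rung : ℕ → ℕ → Bool
  rung P Q = does (Q ℕ.≟ partner P)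

  ladder : SubsetMatrix G M
  ladder p q t = (rail (toℕ p) (toℕ q) ∧ ｛ ε ｝ t) ∨ (rung (toℕ p) (toℕ q) ∧ rungSet (toℕ p) t)

  ｛ε｝-⁻¹ : ∀ t → ｛ ε ｝ (t ⁻¹) ≡ ｛ ε ｝ t
  ｛ε｝-⁻¹ t = does-⇔ (mk⇔ t⁻¹≡ε⇒t≡ε t≡ε⇒t⁻¹≡ε) (t ⁻¹ Fin.≟ ε) (t Fin.≟ ε)
    where
    t⁻¹≡ε⇒t≡ε : t ⁻¹ ≡ ε → t ≡ ε
    t⁻¹≡ε⇒t≡ε t⁻¹≡ε = trans (sym (⁻¹-involutive t)) (trans (cong _⁻¹ t⁻¹≡ε) ε⁻¹≈ε)
    t≡ε⇒t⁻¹≡ε : t ≡ ε → t ⁻¹ ≡ ε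
    t≡ε⇒t⁻¹≡ε t≡ε = trans (cong _⁻¹ t≡ε) ε⁻¹≈ε

  orient-partner : ∀ P t → orient (partner P) t ≡ orient P (t ⁻¹)
  orient-partner P t rewrite colour-partner P with colour P
  ... | true  = sym (⁻¹-involutive t)
  ... | false = refl

  rungSet-partner : ∀ P t → rungSet (partner P) t ≡ rungSet P (t ⁻¹)
  rungSet-partner P t = cong₂ (λ x j → toℕ x <ᵇ (k ∸ 𝟙 (j <ᵇ n))) (orient-partner P t) (partner-⌊/2⌋ P)

  rung-comm : ∀ P Q → rung Q P ≡ rung P Q
  rung-comm P Q = does-⇔ (mk⇔ (flip P Q) (flip Q P)) (P ℕ.≟ partner Q) (Q ℕ.≟ partner P)
    where
    flip : ∀ A B → A ≡ partner B → B ≡ partner A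
    flip A B A≡pB = trans (sym (partner-involutive B)) (cong partner (sym A≡pB))

  rung∧rungSet : ∀ P Q t → rung P Q ∧ rungSet Q t ≡ rung P Q ∧ rungSet P (t ⁻¹)
  rung∧rungSet P Q t with rung P Q in is-rung
  ... | false = refl
  ... | true  = trans (cong (λ R → rungSet R t) (does⇒ (Q ℕ.≟ partner P) is-rung)) (rungSet-partner P t)

  ladder-symmetric : ∀ p q t → ladder q p t ≡ ladder p q (t ⁻¹)
  ladder-symmetric p q t = cong₂ _∨_
    (cong₂ _∧_ (∨-comm (does (P ℕ.≟ 2 + Q)) _) (sym (｛ε｝-⁻¹ t)))
    (trans (cong (_∧ rungSet Q t) (rung-comm P Q)) (rung∧rungSet P Q t))
    where
    P Q : ℕ
    P = toℕ p
    Q = toℕ q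

  ladder-loopless : ∀ p t → ladder p p t ≡ false
  ladder-loopless p t = cong₂ (λ a b → (a ∧ ｛ ε ｝ t) ∨ (b ∧ rungSet P t))
    (cong₂ _∨_ P≢2+P P≢2+P) (dec-false (P ℕ.≟ partner P) (partner≢ P ∘ sym))
    where
    P : ℕ
    P = toℕ p
    P≢2+P : does (P ℕ.≟ 2 + P) ≡ false
    P≢2+P = dec-false (P ℕ.≟ 2 + P) (ℕ.m≢1+n+m P)

  ladder-isCayleyData : IsCayleyData G M ladder
  ladder-isCayleyData = (λ p → ladder-loopless p ε) , ladder-symmetric

  rail-true : ∀ P Q → rail P Q ≡ true → Q ≡ 2 + P ⊎ P ≡ 2 + Q
  rail-true P Q is-rail with ∨-true _ _ is-rail
  ... | inj₁ out = inj₁ (does⇒ (Q ℕ.≟ 2 + P) out)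
  ... | inj₂ in′ = inj₂ (does⇒ (P ℕ.≟ 2 + Q) in′)

  rail⇒¬rung : ∀ P Q → rail P Q ≡ true → rung P Q ≡ false
  rail⇒¬rung P Q is-rail = dec-false (Q ℕ.≟ partner P) (not-rung (rail-true P Q is-rail))
    where
    not-rung : Q ≡ 2 + P ⊎ P ≡ 2 + Q → Q ≢ partner P
    not-rung (inj₁ refl) Q≡pP = partner≢2+ P (sym Q≡pP)
    not-rung (inj₂ refl) Q≡pP = 2+partner≢ (2 + Q) (cong (2 +_) (sym Q≡pP))

  count-rungSet : k ≤ order → ∀ P → count (rungSet P) ≡ rungSize P
  count-rungSet k≤order P = count-oriented (colour P)
    where
    s≤order : rungSize P ≤ order
    s≤order = ℕ.≤-trans (ℕ.m∸n≤m k (𝟙 (⌊ P /2⌋ <ᵇ n))) k≤order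
    count-oriented : ∀ b → count (λ t → toℕ (if b then t ⁻¹ else t) <ᵇ rungSize P) ≡ rungSize P
    count-oriented true  = trans (count-⁻¹ (λ t → toℕ t <ᵇ rungSize P)) (count-toℕ< s≤order)
    count-oriented false = count-toℕ< s≤order

  count-ladder : k ≤ order → ∀ p q →
                 count (ladder p q) ≡ 𝟙 (rail (toℕ p) (toℕ q)) + 𝟙 (rung (toℕ p) (toℕ q)) * rungSize (toℕ p)
  count-ladder k≤order p q = begin
    count (ladder p q)
      ≡⟨ count-∨ _ _ disjoint ⟩
    count (λ t → rail P Q ∧ ｛ ε ｝ t) + count (λ t → rung P Q ∧ rungSet P t)
      ≡⟨ cong₂ _+_ (count-∧ (rail P Q) ｛ ε ｝) (count-∧ (rung P Q) (rungSet P)) ⟩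
    𝟙 (rail P Q) * count ｛ ε ｝ + 𝟙 (rung P Q) * count (rungSet P)
      ≡⟨ cong₂ (λ a b → 𝟙 (rail P Q) * a + 𝟙 (rung P Q) * b) (count-｛｝ ε) (count-rungSet k≤order P) ⟩
    𝟙 (rail P Q) * 1 + 𝟙 (rung P Q) * rungSize P
      ≡⟨ cong (_+ 𝟙 (rung P Q) * rungSize P) (ℕ.*-identityʳ (𝟙 (rail P Q))) ⟩
    𝟙 (rail P Q) + 𝟙 (rung P Q) * rungSize P ∎
    where
    open ≡-Reasoning
    P Q : ℕ
    P = toℕ p
    Q = toℕ q
    disjoint : ∀ t → rail P Q ∧ ｛ ε ｝ t ≡ true → rung P Q ∧ rungSet P t ≡ false
    disjoint t on-rail = cong (_∧ rungSet P t) (rail⇒¬rung P Q (proj₁ (∧-true _ _ on-rail)))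

  partner-<ᵇ-M : ∀ P → (partner P <ᵇ M) ≡ (P <ᵇ M)
  partner-<ᵇ-M zero          = refl
  partner-<ᵇ-M (suc zero)    = refl
  partner-<ᵇ-M (suc (suc P)) =
    trans (<ᵇ-double (partner P) n) (trans (cong (_<ᵇ n) (partner-⌊/2⌋ P)) (sym (<ᵇ-double P n)))

  count-rail-in : ∀ P → P < M → count {M} (λ q → does (P ℕ.≟ 2 + toℕ q)) ≡ 𝟙 (1 <ᵇ P)
  count-rail-in zero          _     = count-∅ {M}
  count-rail-in (suc zero)    _     = count-∅ {M}
  count-rail-in (suc (suc P)) 2+P<M = begin
    count {M} (λ q → does (P ℕ.≟ toℕ q)) ≡⟨ count-cong {M} (λ q → does-≟-comm P (toℕ q)) ⟩
    count {M} (λ q → does (toℕ q ℕ.≟ P)) ≡⟨ count-toℕ≡ M P ⟩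
    𝟙 (P <ᵇ M)                        ≡⟨ cong 𝟙 (<⇒<ᵇ≡true (ℕ.m+n≤o⇒n≤o 2 2+P<M)) ⟩
    1 ∎
    where open ≡-Reasoning

  count-rail : ∀ P → P < M → count {M} (λ q → rail P (toℕ q)) ≡ 𝟙 (2 + P <ᵇ M) + 𝟙 (1 <ᵇ P)
  count-rail P P<M = trans (count-∨ {M} _ _ disjoint) (cong₂ _+_ (count-toℕ≡ M (2 + P)) (count-rail-in P P<M))
    where
    disjoint : ∀ q → does (toℕ q ℕ.≟ 2 + P) ≡ true → does (P ℕ.≟ 2 + toℕ q) ≡ false
    disjoint q out = dec-false (P ℕ.≟ 2 + toℕ q)
      (λ P≡2+Q → ℕ.m≢1+n+m P (trans P≡2+Q (cong (2 +_) (does⇒ (toℕ q ℕ.≟ 2 + P) out))))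

  count-rung : ∀ P → P < M → count {M} (λ q → rung P (toℕ q)) ≡ 1
  count-rung P P<M = trans (count-toℕ≡ M (partner P)) (cong 𝟙 (trans (partner-<ᵇ-M P) (<⇒<ᵇ≡true P<M)))

  ladder-row : k ≤ order → ∀ p →
    sum {M} (λ q → count (ladder p q)) ≡ 𝟙 (1 <ᵇ toℕ p) + (𝟙 (2 + toℕ p <ᵇ M) + rungSize (toℕ p))
  ladder-row k≤order p = begin
    sum (λ q → count (ladder p q))
      ≡⟨ sum-cong-≗ {M} (count-ladder k≤order p) ⟩
    sum {M} (λ q → 𝟙 (rail P (toℕ q)) + 𝟙 (rung P (toℕ q)) * s)
      ≡⟨ ∑-distrib-+ {M} (𝟙 ∘ rail P ∘ toℕ) (λ q → 𝟙 (rung P (toℕ q)) * s) ⟩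
    count {M} (rail P ∘ toℕ) + sum {M} (λ q → 𝟙 (rung P (toℕ q)) * s)
      ≡⟨ cong (count {M} (rail P ∘ toℕ) +_) (sym (*-distribʳ-sum {M} s (𝟙 ∘ rung P ∘ toℕ))) ⟩
    count {M} (rail P ∘ toℕ) + count {M} (rung P ∘ toℕ) * s
      ≡⟨ cong₂ (λ a b → a + b * s) (count-rail P P<M) (count-rung P P<M) ⟩
    (𝟙 (2 + P <ᵇ M) + 𝟙 (1 <ᵇ P)) + 1 * s
      ≡⟨ cong₂ _+_ (ℕ.+-comm (𝟙 (2 + P <ᵇ M)) (𝟙 (1 <ᵇ P))) (ℕ.*-identityˡ s) ⟩
    (𝟙 (1 <ᵇ P) + 𝟙 (2 + P <ᵇ M)) + s
      ≡⟨ ℕ.+-assoc (𝟙 (1 <ᵇ P)) _ s ⟩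
    𝟙 (1 <ᵇ P) + (𝟙 (2 + P <ᵇ M) + s) ∎
    where
    open ≡-Reasoning
    P s : ℕ
    P = toℕ p
    s = rungSize P
    P<M : P < M
    P<M = Fin.toℕ<n p

  successor+rungSize : 1 ≤ k → ∀ P → 𝟙 (2 + P <ᵇ M) + rungSize P ≡ k
  successor+rungSize 1≤k P = trans (cong (λ b → 𝟙 b + rungSize P) (<ᵇ-double P n))
                                   (ℕ.m+[n∸m]≡n (ℕ.≤-trans (𝟙≤1 (⌊ P /2⌋ <ᵇ n)) 1≤k))

  ladder-true : ∀ p q t → ladder p q t ≡ true →
                (rail (toℕ p) (toℕ q) ≡ true × t ≡ ε) ⊎ rung (toℕ p) (toℕ q) ≡ true
  ladder-true p q t edge with ∨-true _ _ edge
  ... | inj₁ on-rail = let (is-rail , t∈｛ε｝) = ∧-true _ _ on-rail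
                       in inj₁ (is-rail , does⇒ (t Fin.≟ ε) t∈｛ε｝)
  ... | inj₂ on-rung = inj₂ (proj₁ (∧-true _ _ on-rung))

  ladder-colour : ∀ p q t → ladder p q t ≡ true → colour (toℕ q) ≡ not (colour (toℕ p))
  ladder-colour p q t edge with ladder-true p q t edge
  ... | inj₂ is-rung = trans (cong colour (does⇒ (toℕ q ℕ.≟ partner (toℕ p)) is-rung)) (colour-partner (toℕ p))
  ... | inj₁ (is-rail , _) with rail-true (toℕ p) (toℕ q) is-rail
  ...   | inj₁ Q≡2+P = cong colour Q≡2+P
  ...   | inj₂ P≡2+Q = trans (sym (not-involutive _)) (cong not (sym (cong colour P≡2+Q)))

  ladder-forward : ∀ p q t → ladder p q t ≡ true → (toℕ q ≡ 2 + toℕ p × t ≡ ε) ⊎ toℕ q < 2 + toℕ p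
  ladder-forward p q t edge with ladder-true p q t edge
  ... | inj₂ is-rung =
        inj₂ (subst (_< 2 + toℕ p) (sym (does⇒ (toℕ q ℕ.≟ partner (toℕ p)) is-rung)) (partner<2+ (toℕ p)))
  ... | inj₁ (is-rail , t≡ε) with rail-true (toℕ p) (toℕ q) is-rail
  ...   | inj₁ Q≡2+P = inj₁ (Q≡2+P , t≡ε)
  ...   | inj₂ P≡2+Q = inj₂ (subst (toℕ q <_) (cong (2 +_) (sym P≡2+Q)) (ℕ.m<n+m (toℕ q) (s≤s z≤n)))

  ladder-rail : ∀ p q → toℕ q ≡ 2 + toℕ p → ladder p q ε ≡ true
  ladder-rail p q Q≡2+P rewrite dec-true (toℕ q ℕ.≟ 2 + toℕ p) Q≡2+P | dec-true (ε Fin.≟ ε) refl = refl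

-- Gluing the ladder to Σ

module LadderExtension (G : FinGroup) {m : ℕ} (T : SubsetMatrix G m) (a₀ a₁ : Fin m) (n k : ℕ) where
  open FinGroup G
  open CayleyGraph G
  open Ladder G n k

  -- The rails start at ladder parts 0 and 1, joined by identity matchings to the parts a₀ and a₁ of Σ.
  foot : Fin m → Fin M → Bool
  foot a q = (｛ zero ｝ q ∧ ｛ a₀ ｝ a) ∨ (｛ suc zero ｝ q ∧ ｛ a₁ ｝ a)

  attachments : Fin m → ℕ
  attachments a = 𝟙 (｛ a₀ ｝ a) + 𝟙 (｛ a₁ ｝ a)

  attach : Fin m → Fin M → Fin order → Bool
  attach a q t = foot a q ∧ ｛ ε ｝ t

  open Gluing G T attach ladder renaming (glue to extended) public

  feet-disjoint : ∀ (q : Fin M) b c → ｛ zero ｝ q ∧ b ≡ true → ｛ suc zero ｝ q ∧ c ≡ false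
  feet-disjoint zero    b c _  = refl
  feet-disjoint (suc q) b c ()

  count-foot-row : ∀ a → count (foot a) ≡ attachments a
  count-foot-row a = trans (count-∨ _ _ (λ q → feet-disjoint q (｛ a₀ ｝ a) (｛ a₁ ｝ a)))
    (cong₂ _+_ (at-rail-start zero a₀) (at-rail-start (suc zero) a₁))
    where
    at-rail-start : ∀ (r : Fin M) c → count (λ q → ｛ r ｝ q ∧ ｛ c ｝ a) ≡ 𝟙 (｛ c ｝ a)
    at-rail-start r c = begin
      count (λ q → ｛ r ｝ q ∧ ｛ c ｝ a) ≡⟨ count-cong (λ q → ∧-comm (｛ r ｝ q) (｛ c ｝ a)) ⟩
      count (λ q → ｛ c ｝ a ∧ ｛ r ｝ q) ≡⟨ count-∧ (｛ c ｝ a) ｛ r ｝ ⟩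
      𝟙 (｛ c ｝ a) * count ｛ r ｝       ≡⟨ cong (𝟙 (｛ c ｝ a) *_) (count-｛｝ r) ⟩
      𝟙 (｛ c ｝ a) * 1                  ≡⟨ ℕ.*-identityʳ _ ⟩
      𝟙 (｛ c ｝ a) ∎
      where open ≡-Reasoning

  count-foot-column : ∀ (q : Fin M) → count (λ a → foot a q) ≡ 𝟙 (｛ zero ｝ q) + 𝟙 (｛ suc zero ｝ q)
  count-foot-column q = trans (count-∨ _ _ (λ a → feet-disjoint q (｛ a₀ ｝ a) (｛ a₁ ｝ a)))
    (cong₂ _+_ (at-rail-start zero a₀) (at-rail-start (suc zero) a₁))
    where
    at-rail-start : ∀ (r : Fin M) (c : Fin m) → count (λ a → ｛ r ｝ q ∧ ｛ c ｝ a) ≡ 𝟙 (｛ r ｝ q)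
    at-rail-start r c =
      trans (count-∧ (｛ r ｝ q) ｛ c ｝) (trans (cong (𝟙 (｛ r ｝ q) *_) (count-｛｝ c)) (ℕ.*-identityʳ _))

  count-attach : ∀ a q → count (attach a q) ≡ 𝟙 (foot a q)
  count-attach a q =
    trans (count-∧ (foot a q) ｛ ε ｝) (trans (cong (𝟙 (foot a q) *_) (count-｛｝ ε)) (ℕ.*-identityʳ _))

  foot-a₀ : foot a₀ zero ≡ true
  foot-a₀ = cong (_∨ false) (dec-true (a₀ Fin.≟ a₀) refl)

  foot-a₁ : foot a₁ (suc zero) ≡ true
  foot-a₁ = dec-true (a₁ Fin.≟ a₁) refl

  one-rail-predecessor : ∀ (q : Fin M) → 𝟙 (｛ zero ｝ q) + 𝟙 (｛ suc zero ｝ q) + 𝟙 (1 <ᵇ toℕ q) ≡ 1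
  one-rail-predecessor zero          = refl
  one-rail-predecessor (suc zero)    = refl
  one-rail-predecessor (suc (suc q)) = refl

  foot-true : ∀ a q → foot a q ≡ true → (q ≡ zero × a ≡ a₀) ⊎ (q ≡ suc zero × a ≡ a₁)
  foot-true a q at-foot with ∨-true _ _ at-foot
  ... | inj₁ first  = let (is-0 , is-a₀) = ∧-true _ _ first
                      in inj₁ (does⇒ (q Fin.≟ zero) is-0 , does⇒ (a Fin.≟ a₀) is-a₀)
  ... | inj₂ second = let (is-1 , is-a₁) = ∧-true _ _ second
                      in inj₂ (does⇒ (q Fin.≟ suc zero) is-1 , does⇒ (a Fin.≟ a₁) is-a₁)

  foot-part-unique : ∀ {a a′} q → foot a q ≡ true → foot a′ q ≡ true → a ≡ a′
  foot-part-unique {a} {a′} q at-foot at-foot′ with foot-true a q at-foot | foot-true a′ q at-foot′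
  ... | inj₁ (_ , refl)    | inj₁ (_ , refl)   = refl
  ... | inj₂ (_ , refl)    | inj₂ (_ , refl)   = refl
  ... | inj₁ (refl , _)    | inj₂ (() , _)
  ... | inj₂ (refl , _)    | inj₁ (() , _)

  foot-rail-unique : a₀ ≢ a₁ → ∀ a {q q′} → foot a q ≡ true → foot a q′ ≡ true → q ≡ q′
  foot-rail-unique a₀≢a₁ a {q} {q′} at-foot at-foot′ with foot-true a q at-foot | foot-true a q′ at-foot′
  ... | inj₁ (refl , _)    | inj₁ (refl , _)    = refl
  ... | inj₂ (refl , _)    | inj₂ (refl , _)    = refl
  ... | inj₁ (_ , refl)    | inj₂ (_ , a₀≡a₁)   = ⊥-elim (a₀≢a₁ a₀≡a₁)
  ... | inj₂ (_ , refl)    | inj₁ (_ , a₁≡a₀)   = ⊥-elim (a₀≢a₁ (sym a₁≡a₀))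

  extended-regular : 1 ≤ k → k ≤ order → (∀ g a → valency G m T (g , a) + attachments a ≡ suc k) →
                     IsRegular G (m + M) extended
  extended-regular 1≤k k≤order Σ-valency = suc k , λ v → valency-of (side v)
    where
    open ≡-Reasoning
    valency-of : ∀ {v} → Side v → valency G (m + M) extended v ≡ suc k
    valency-of (old (g , a)) = begin
      valency G (m + M) extended (inl (g , a))               ≡⟨ valency-inl g a ⟩
      valency G m T (g , a) + sum (λ q → count (attach a q)) ≡⟨ cong (valency G m T (g , a) +_) attached ⟩
      valency G m T (g , a) + attachments a                 ≡⟨ Σ-valency g a ⟩
      suc k ∎
      where
      attached : sum (λ q → count (attach a q)) ≡ attachments a
      attached = trans (sum-cong-≗ (count-attach a)) (count-foot-row a)
    valency-of (new (g , q)) = begin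
      valency G (m + M) extended (inr (g , q))
        ≡⟨ valency-inr g q ⟩
      sum (λ a → count (attach a q)) + valency G M ladder (g , q)
        ≡⟨ cong₂ _+_ from-Σ from-ladder ⟩
      (𝟙 (｛ zero ｝ q) + 𝟙 (｛ suc zero ｝ q)) + (𝟙 (1 <ᵇ Q) + (𝟙 (2 + Q <ᵇ M) + rungSize Q))
        ≡⟨ sym (ℕ.+-assoc (𝟙 (｛ zero ｝ q) + 𝟙 (｛ suc zero ｝ q)) (𝟙 (1 <ᵇ Q)) _) ⟩
      (𝟙 (｛ zero ｝ q) + 𝟙 (｛ suc zero ｝ q) + 𝟙 (1 <ᵇ Q)) + (𝟙 (2 + Q <ᵇ M) + rungSize Q)
        ≡⟨ cong₂ _+_ (one-rail-predecessor q) (successor+rungSize 1≤k Q) ⟩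
      suc k ∎
      where
      Q : ℕ
      Q = toℕ q
      from-Σ : sum (λ a → count (attach a q)) ≡ 𝟙 (｛ zero ｝ q) + 𝟙 (｛ suc zero ｝ q)
      from-Σ = trans (sum-cong-≗ (λ a → count-attach a q)) (count-foot-column q)
      from-ladder : valency G M ladder (g , q) ≡ 𝟙 (1 <ᵇ Q) + (𝟙 (2 + Q <ᵇ M) + rungSize Q)
      from-ladder = trans (valency≡∑count M ladder g q) (ladder-row k≤order q)

  module _ (T-cayley : IsCayleyData G m T) (T-empty : DiagEmpty G m T) where
    open IsGroup isGroup using () renaming (inverseʳ to x∙x⁻¹≡ε)
    open GroupProperties (asGroup G) using (x∙y⁻¹≈ε⇒x≈y)

    extended-isCayleyData : IsCayleyData G (m + M) extended
    extended-isCayleyData = glue-isCayleyData T-cayley ladder-isCayleyData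

    extended-diagEmpty : DiagEmpty G (m + M) extended
    extended-diagEmpty = glue-diagEmpty T-empty ladder-loopless

    private
      _~_ : Vertex G (m + M) → Vertex G (m + M) → Set
      _~_ = Adj G (m + M) extended

      ~-sym : ∀ {u v} → u ~ v → v ~ u
      ~-sym {u} {v} = Adj-symmetric extended-isCayleyData u v

      ~-irrefl : ∀ v → ¬ v ~ v
      ~-irrefl = Adj-irreflexive {T = extended} extended-diagEmpty

      IsAutomorphism⁺ : (Vertex G (m + M) → Vertex G (m + M)) → Set
      IsAutomorphism⁺ = IsAutomorphism G (m + M) extended

    inl-inr-adjacent : ∀ {y a x q} → inl (y , a) ~ inr (x , q) → x ≡ y × foot a q ≡ true
    inl-inr-adjacent {y} {a} {x} {q} edge =
      let (at-foot , is-ε) = ∧-true _ _ (trans (sym (adjB-inl-inr y a x q)) edge)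
      in x∙y⁻¹≈ε⇒x≈y x y (does⇒ ((x ∙ (y ⁻¹)) Fin.≟ ε) is-ε) , at-foot

    foot-edge : ∀ {a q} x → foot a q ≡ true → inl (x , a) ~ inr (x , q)
    foot-edge {a} {q} x at-foot = trans (adjB-inl-inr x a x q)
      (cong₂ _∧_ at-foot (trans (cong ｛ ε ｝ (x∙x⁻¹≡ε x)) (dec-true (ε Fin.≟ ε) refl)))

    old-neighbour-unique : ∀ {u u′ w} → inl u ~ inr w → inl u′ ~ inr w → u ≡ u′
    old-neighbour-unique {y , a} {y′ , a′} {x , q} edge edge′ =
      let (x≡y , at-foot) = inl-inr-adjacent {y} {a} {x} {q} edge
          (x≡y′ , at-foot′) = inl-inr-adjacent {y′} {a′} {x} {q} edge′
      in cong₂ _,_ (trans (sym x≡y) x≡y′) (foot-part-unique q at-foot at-foot′)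

    new-neighbour-unique : a₀ ≢ a₁ → ∀ {u w w′} → inl u ~ inr w → inl u ~ inr w′ → w ≡ w′
    new-neighbour-unique a₀≢a₁ {y , a} {x , q} {x′ , q′} edge edge′ =
      let (x≡y , at-foot) = inl-inr-adjacent {y} {a} {x} {q} edge
          (x′≡y , at-foot′) = inl-inr-adjacent {y} {a} {x′} {q′} edge′
      in cong₂ _,_ (trans x≡y (sym x′≡y)) (foot-rail-unique a₀≢a₁ a at-foot at-foot′)

    inr-colour : ∀ {x p y q} → inr (x , p) ~ inr (y , q) → colour (toℕ q) ≡ not (colour (toℕ p))
    inr-colour {x} {p} {y} {q} edge = ladder-colour p q (y ∙ (x ⁻¹)) (trans (sym (adjB-inr-inr (x , p) (y , q))) edge)

    inr-triangle-free : a₀ ≢ a₁ → ∀ w → ¬ HasTriangleThrough G (m + M) extended (inr w)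
    inr-triangle-free a₀≢a₁ w (u , u′ , w~u , u~u′ , u′~w) = triangle (side u) (side u′) w~u u~u′ u′~w
      where
      triangle : ∀ {u u′} → Side u → Side u′ → inr w ~ u → u ~ u′ → u′ ~ inr w → ⊥
      triangle (old u) (old u′) w~u u~u′ u′~w =
        ~-irrefl (inl u′) (subst (λ z → inl z ~ inl u′) (old-neighbour-unique (~-sym w~u) u′~w) u~u′)
      triangle (old u) (new w′) w~u u~u′ u′~w =
        ~-irrefl (inr w) (subst (λ z → inr z ~ inr w) (sym (new-neighbour-unique a₀≢a₁ (~-sym w~u) u~u′)) u′~w)
      triangle (new w′) (old u′) w~u u~u′ u′~w =
        ~-irrefl (inr w) (subst (λ z → inr w ~ inr z) (sym (new-neighbour-unique a₀≢a₁ u′~w (~-sym u~u′))) w~u)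
      triangle (new (y , q)) (new (z , r)) w~u u~u′ u′~w =
        not-¬ refl (trans (inr-colour u′~w)
                          (trans (cong not (trans (inr-colour u~u′) (cong not (inr-colour w~u)))) (not-involutive _)))

    module _ (a₀≢a₁ : a₀ ≢ a₁) (Σ-autIsoG : AutIsoG G m T)
             (Σ-triangles : ∀ v → HasTriangleThrough G m T v) where
      open Automorphisms G T using (AutIsoG⇒rightTranslations)
      open Automorphisms G extended using (IsRightTranslation; inverse-isAutomorphism; triangle-preserved;
                                           agreement-propagates; rightTranslations⇒AutIsoG)

      inl-~ : ∀ u v → Adj G m T u v → inl u ~ inl v
      inl-~ u v = trans (adjB-inl-inl u v)

      ~-inl : ∀ u v → inl u ~ inl v → Adj G m T u v
      ~-inl u v = trans (sym (adjB-inl-inl u v))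

      inl-triangle : ∀ u → HasTriangleThrough G (m + M) extended (inl u)
      inl-triangle u with Σ-triangles u
      ... | v , w , u~v , v~w , w~u = inl v , inl w , inl-~ u v u~v , inl-~ v w v~w , inl-~ w u w~u

      triangle⇒old : ∀ {v} → Side v → HasTriangleThrough G (m + M) extended v → ∃[ u ] inl u ≡ v
      triangle⇒old (old u) _   = u , refl
      triangle⇒old (new w) tri = ⊥-elim (inr-triangle-free a₀≢a₁ w tri)

      restriction : ∀ {σ} → IsAutomorphism⁺ σ → ∀ u → ∃[ u′ ] inl u′ ≡ σ (inl u)
      restriction {σ} σ-aut u = triangle⇒old (side (σ (inl u))) (triangle-preserved σ-aut (inl u) (inl-triangle u))

      restrict : ∀ {σ} → IsAutomorphism⁺ σ → Vertex G m → Vertex G m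
      restrict σ-aut u = proj₁ (restriction σ-aut u)

      inl-restrict : ∀ {σ} (σ-aut : IsAutomorphism⁺ σ) u → inl (restrict σ-aut u) ≡ σ (inl u)
      inl-restrict σ-aut u = proj₂ (restriction σ-aut u)

      restrict-isAutomorphism : ∀ {σ} (σ-aut : IsAutomorphism⁺ σ) → IsAutomorphism G m T (restrict σ-aut)
      restrict-isAutomorphism {σ} σ-aut = record
        { inverse   = τ⁻¹
        ; inverseˡ  = λ u → inl-injective (cancel σ⁻¹-aut σ-aut inverseˡ u)
        ; inverseʳ  = λ u → inl-injective (cancel σ-aut σ⁻¹-aut inverseʳ u)
        ; preserves = λ u v → mk⇔
            (λ u~v → ~-inl _ _ (subst₂ _~_ (sym (inl-restrict σ-aut u)) (sym (inl-restrict σ-aut v))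
                                   (Equivalence.to (preserves (inl u) (inl v)) (inl-~ u v u~v))))
            (λ τu~τv → ~-inl u v (Equivalence.from (preserves (inl u) (inl v))
                                   (subst₂ _~_ (inl-restrict σ-aut u) (inl-restrict σ-aut v) (inl-~ _ _ τu~τv))))
        }
        where
        open IsAutomorphism σ-aut
        σ⁻¹-aut : IsAutomorphism⁺ inverse
        σ⁻¹-aut = inverse-isAutomorphism σ-aut
        τ⁻¹ : Vertex G m → Vertex G m
        τ⁻¹ = restrict σ⁻¹-aut
        cancel : ∀ {π π′} (π-aut : IsAutomorphism⁺ π) (π′-aut : IsAutomorphism⁺ π′) →
                 (∀ v → π (π′ v) ≡ v) → ∀ u → inl (restrict π-aut (restrict π′-aut u)) ≡ inl u
        cancel {π} π-aut π′-aut π∘π′≗id u =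
          trans (inl-restrict π-aut _) (trans (cong π (inl-restrict π′-aut u)) (π∘π′≗id (inl u)))

      module Agreement {σ} (σ-aut : IsAutomorphism⁺ σ) where
        restriction-translation : ∃[ h ] ρ h ≗ restrict σ-aut
        restriction-translation =
          AutIsoG⇒rightTranslations a₀ Σ-autIsoG (restrict σ-aut) (restrict-isAutomorphism σ-aut)

        h : Fin order
        h = proj₁ restriction-translation

        Agrees : Vertex G (m + M) → Set
        Agrees v = σ v ≡ ρ h v

        old-agrees : ∀ u → Agrees (inl u)
        old-agrees u@(x , a) = trans (sym (inl-restrict σ-aut u)) (cong inl (sym (proj₂ restriction-translation u)))

        propagate : ∀ {u v} → Agrees u → u ~ v → (∀ w → u ~ w → Agrees w ⊎ w ≡ v) → Agrees v
        propagate = agreement-propagates σ-aut (ρ-isAutomorphism extended h)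

        rail-start : ∀ {a q} x → foot a q ≡ true → Agrees (inr (x , q))
        rail-start {a} {q} x at-foot =
          propagate (old-agrees (x , a)) (foot-edge x at-foot) (λ w → neighbour (side w))
          where
          neighbour : ∀ {w} → Side w → inl (x , a) ~ w → Agrees w ⊎ w ≡ inr (x , q)
          neighbour (old u) _    = inj₁ (old-agrees u)
          neighbour (new w) edge = inj₂ (cong inr (new-neighbour-unique a₀≢a₁ edge (foot-edge x at-foot)))

        rail-step : ∀ x p q → toℕ q ≡ 2 + toℕ p → Agrees (inr (x , p)) →
                    (∀ y r → toℕ r < toℕ q → Agrees (inr (y , r))) → Agrees (inr (x , q))
        rail-step x p q Q≡2+P p-agrees lower-agree = propagate p-agrees rail-edge (λ w → neighbour (side w))
          where
          rail-edge : inr (x , p) ~ inr (x , q)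
          rail-edge = trans (adjB-inr-inr (x , p) (x , q))
                            (subst (λ t → ladder p q t ≡ true) (sym (x∙x⁻¹≡ε x)) (ladder-rail p q Q≡2+P))
          neighbour : ∀ {w} → Side w → inr (x , p) ~ w → Agrees w ⊎ w ≡ inr (x , q)
          neighbour (old u) _ = inj₁ (old-agrees u)
          neighbour (new (y , r)) edge
            with ladder-forward p r (y ∙ (x ⁻¹)) (trans (sym (adjB-inr-inr (x , p) (y , r))) edge)
          ... | inj₁ (R≡2+P , y∙x⁻¹≡ε) =
                inj₂ (cong inr (cong₂ _,_ (x∙y⁻¹≈ε⇒x≈y y x y∙x⁻¹≡ε)
                                          (Fin.toℕ-injective (trans R≡2+P (sym Q≡2+P)))))
          ... | inj₂ R<2+P = inj₁ (lower-agree y r (subst (toℕ r <_) (sym Q≡2+P) R<2+P))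

        -- Induction on the position: apart from q itself, every neighbour of the rail predecessor of q
        -- lies in Σ or at a smaller position.
        AgreesAt : ℕ → Set
        AgreesAt Q = ∀ x (q : Fin M) → toℕ q ≡ Q → Agrees (inr (x , q))

        agrees-at : ∀ Q → (∀ {R} → R < Q → AgreesAt R) → AgreesAt Q
        agrees-at _ _     x zero          _    = rail-start {a₀} x foot-a₀
        agrees-at _ _     x (suc zero)    _    = rail-start {a₁} x foot-a₁
        agrees-at _ lower x (suc (suc q)) refl =
          rail-step x p (suc (suc q)) Q≡2+P (lower P<Q x p refl) (λ y r R<Q → lower R<Q y r refl)
          where
          p : Fin M
          p = inject₁ (inject₁ q)
          Q≡2+P : 2 + toℕ q ≡ 2 + toℕ p
          Q≡2+P = cong (2 +_) (sym (trans (Fin.toℕ-inject₁ (inject₁ q)) (Fin.toℕ-inject₁ q)))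
          P<Q : toℕ p < 2 + toℕ q
          P<Q = subst (toℕ p <_) (sym Q≡2+P) (ℕ.m<n+m (toℕ p) (s≤s z≤n))

        agrees : ∀ {v} → Side v → Agrees v
        agrees (old u)       = old-agrees u
        agrees (new (x , q)) = <-rec AgreesAt agrees-at (toℕ q) x q refl

      extended-rightTranslations : ∀ σ → IsAutomorphism⁺ σ → IsRightTranslation σ
      extended-rightTranslations σ σ-aut = h , λ v → sym (agrees (side v))
        where open Agreement σ-aut

      extended-autIsoG : AutIsoG G (m + M) extended
      extended-autIsoG = rightTranslations⇒AutIsoG (a₀ ↑ˡ M) extended-rightTranslations

lemma2p4 : (G : FinGroup) (T : SubsetMatrix G 5) (k : ℕ) →
    IsPGSR G 5 T →
    2 ≤ k → k ≤ FinGroup.order G →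
    ((g : Fin (FinGroup.order G)) →
      valency G 5 T (g , zero) ≡ suc k × valency G 5 T (g , suc zero) ≡ suc k
      × valency G 5 T (g , suc (suc zero)) ≡ suc k) →
    ((g : Fin (FinGroup.order G)) →
      valency G 5 T (g , suc (suc (suc zero))) ≡ k
      × valency G 5 T (g , suc (suc (suc (suc zero)))) ≡ k) →
    ((v : Vertex G 5) → HasTriangleThrough G 5 T v) →
    (n : ℕ) → HasHGR G (7 + 2 * n)
lemma2p4 G T k (T-cayley , T-empty , Σ-autIsoG) 2≤k k≤order valency-k+1 valency-k Σ-triangles n =
  s≤s (s≤s z≤n) , extended ,
  extended-isCayleyData T-cayley T-empty , extended-diagEmpty T-cayley T-empty ,
  extended-regular (ℕ.≤-trans (s≤s z≤n) 2≤k) k≤order Σ-valency ,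
  extended-autIsoG T-cayley T-empty (λ ()) Σ-autIsoG Σ-triangles
  where
  open LadderExtension G T (suc (suc (suc zero))) (suc (suc (suc (suc zero)))) n k
  Σ-valency : ∀ g a → valency G 5 T (g , a) + attachments a ≡ suc k
  Σ-valency g zero                            = trans (ℕ.+-identityʳ _) (proj₁ (valency-k+1 g))
  Σ-valency g (suc zero)                      = trans (ℕ.+-identityʳ _) (proj₁ (proj₂ (valency-k+1 g)))
  Σ-valency g (suc (suc zero))                = trans (ℕ.+-identityʳ _) (proj₂ (proj₂ (valency-k+1 g)))
  Σ-valency g (suc (suc (suc zero)))          = trans (cong (_+ 1) (proj₁ (valency-k g))) (ℕ.+-comm k 1)
  Σ-valency g (suc (suc (suc (suc zero))))    = trans (cong (_+ 1) (proj₂ (valency-k g))) (ℕ.+-comm k 1)
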